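{- Every (finite) tree is $132$-representable by a $2$-uniform word, i.e., for some labeling of its vertices by distinct elements of a totally ordered set it is represented by a $132$-avoiding word in which every letter occurs exactly twice.
   Context: A word is a finite sequence of letters from a totally ordered alphabet. Two letters $x,y$ alternate in a word $w$ if between any two occurrences of $x$ there is an occurrence of $y$ and between any two occurrences of $y$ there is an occurrence of $x$. A graph $G=(V,E)$ is represented by a word $w$ over $V$ if for all distinct $x,y\in V$, $x$ and $y$ alternate in $w$ if and only if $xy\in E$. A word $w_1\cdots w_n$ contains the pattern $132$ if there are indices $i<j<l$ with $w_i<w_l<w_j$, and is $132$-avoiding otherwise. -}

module Defs where

open import Data.Nat as ℕ using (ℕ; _≤_)
open import Data.Fin as Fin using (Fin; _≟_)
open import Data.Bool using (Bool; true; false)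
open import Data.Unit using (⊤)
open import Data.Empty using (⊥)
open import Data.List using (List; []; _∷_; _∷ʳ_; length; lookup; filter; map)
open import Data.List.Relation.Unary.AllPairs using (AllPairs)
open import Data.Product using (Σ; ∃; ∃-syntax; _×_; _,_)
open import Relation.Binary.PropositionalEquality using (_≡_; _≢_)
open import Relation.Nullary using (¬_)
open import Function.Definitions using (Injective)

record Graph (n : ℕ) : Set where
  field
    adj    : Fin n → Fin n → Bool
    adj-sym    : ∀ u v → adj u v ≡ adj v u
    adj-irrefl : ∀ v → adj v v ≡ false
open Graph public

Edge : ∀ {n} → Graph n → Fin n → Fin n → Set
Edge G u v = adj G u v ≡ true

data Walk {n} (G : Graph n) : Fin n → Fin n → Set where
  stop : ∀ v → Walk G v v
  step : ∀ {u w v} → Edge G u w → Walk G w v → Walk G u v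

Connected : ∀ {n} → Graph n → Set
Connected G = ∀ u v → Walk G u v

Chain : ∀ {n} → Graph n → List (Fin n) → Set
Chain G []            = ⊤
Chain G (x ∷ [])      = ⊤
Chain G (x ∷ y ∷ xs)  = Edge G x y × Chain G (y ∷ xs)

IsCycle : ∀ {n} → Graph n → List (Fin n) → Set
IsCycle G []       = ⊥
IsCycle G (x ∷ xs) =
  (3 ≤ length (x ∷ xs)) × AllPairs _≢_ (x ∷ xs) × Chain G ((x ∷ xs) ∷ʳ x)

Acyclic : ∀ {n} → Graph n → Set
Acyclic {n} G = ∀ (c : List (Fin n)) → ¬ IsCycle G c

IsTree : ∀ {n} → Graph n → Set
IsTree G = Connected G × Acyclic G

BetweenAny : ∀ {A : Set} → List A → A → A → Set
BetweenAny w x y =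
  ∀ (i j : Fin (length w)) → i Fin.< j → lookup w i ≡ x → lookup w j ≡ x →
  ∃[ k ] (i Fin.< k × k Fin.< j × lookup w k ≡ y)

Alternate : ∀ {A : Set} → List A → A → A → Set
Alternate w x y = BetweenAny w x y × BetweenAny w y x

Represents : ∀ {n} → List (Fin n) → Graph n → Set
Represents w G = ∀ x y → x ≢ y → (Alternate w x y → Edge G x y) × (Edge G x y → Alternate w x y)

occ : ∀ {n} → List (Fin n) → Fin n → ℕ
occ w v = length (filter (_≟ v) w)

TwoUniform : ∀ {n} → List (Fin n) → Set
TwoUniform {n} w = ∀ (v : Fin n) → occ w v ≡ 2

Contains132 : List ℕ → Set
Contains132 w = ∃[ i ] ∃[ j ] ∃[ l ]
  (i Fin.< j × j Fin.< l × lookup w i ℕ.< lookup w l × lookup w l ℕ.< lookup w j)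

Avoids132 : List ℕ → Set
Avoids132 w = ¬ Contains132 w

TwoUniform132Representable : ∀ {n} → Graph n → Set
TwoUniform132Representable {n} G =
  ∃[ ℓ ] Injective _≡_ _≡_ ℓ ×
  ∃[ w ] (TwoUniform w × Represents w G × Avoids132 (map ℓ w))

module Submission where

-- Root the tree at vertex 0 and explore it depth first, giving each newly
-- discovered vertex the next natural number as label, so that it carries
-- the largest label so far.  The word starts as  r r.  When u is discovered
-- from a, the word  P ++ Q, where P ends with the block of a on the search
-- stack, becomes  u ∷ P ++ u ∷ Q.  The stack discipline ensures that P
-- contains a once and every other letter 0 or 2 times, so u alternates with
-- a and nothing else; and that every label in Q is at most every label in
-- P, so the new maximum cannot be the 3 of a 132 pattern.  Alternation of
-- two old letters depends only on the subword over them and is unchanged.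
-- Acyclicity makes a the only explored neighbour of u, and connectivity
-- makes the search explore every vertex.

open import Defs
open import Data.Nat using (ℕ; zero; suc; z≤n; s≤s; _≤_; _<_; _+_)
import Data.Nat.Properties as ℕP
open import Data.Fin as Fin using (Fin; _≟_; zero; suc)
import Data.Fin.Properties as FinP
open import Data.Bool as Bool using (Bool; true; false; if_then_else_)
open import Data.Unit using (⊤; tt)
open import Data.Empty using (⊥; ⊥-elim)
open import Data.Sum using (_⊎_; inj₁; inj₂; swap)
open import Data.Product using (∃; ∃-syntax; _×_; _,_; proj₁; proj₂)
open import Data.List using (List; []; _∷_; _++_; _∷ʳ_; length; lookup; filter; map; replicate; allFin)
open import Data.List.Properties using (length-++; filter-++; filter-accept; filter-reject; filter-≐; ++-assoc; ++-identityʳ; map-++)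
open import Data.List.Relation.Unary.All as All using (All; []; _∷_)
import Data.List.Relation.Unary.All.Properties as AllP
open import Data.List.Relation.Unary.Any as Any using (Any; here; there)
import Data.List.Relation.Unary.Any.Properties as AnyP
open import Data.List.Relation.Unary.AllPairs using (AllPairs; []; _∷_)
import Data.List.Relation.Unary.AllPairs.Properties as AllPairsP
open import Data.List.Membership.Propositional.Properties using (∈-allFin)
open import Relation.Binary.PropositionalEquality
open import Relation.Nullary using (¬_; yes; no; Dec; does)
open import Relation.Nullary.Decidable using (_×-dec_)

module _ {n : ℕ} where

  PrecededBy : List (Fin n) → Fin n → Fin n → Set
  PrecededBy []      x y = ⊤
  PrecededBy (b ∷ w) x y = b ≡ y ⊎ (b ≢ x × PrecededBy w x y)

  PrecededByᵢ : List (Fin n) → Fin n → Fin n → Set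
  PrecededByᵢ w x y =
    ∀ (j : Fin (length w)) → lookup w j ≡ x → ∃[ k ] (k Fin.< j × lookup w k ≡ y)

  precededBy⇒ᵢ : ∀ w x y → x ≢ y → PrecededBy w x y → PrecededByᵢ w x y
  precededBy⇒ᵢ (b ∷ w) x y x≢y (inj₁ b≡y) zero    b≡x = ⊥-elim (x≢y (trans (sym b≡x) b≡y))
  precededBy⇒ᵢ (b ∷ w) x y x≢y (inj₁ b≡y) (suc j) _   = zero , s≤s z≤n , b≡y
  precededBy⇒ᵢ (b ∷ w) x y x≢y (inj₂ (b≢x , _)) zero b≡x = ⊥-elim (b≢x b≡x)
  precededBy⇒ᵢ (b ∷ w) x y x≢y (inj₂ (_ , p)) (suc j) e with precededBy⇒ᵢ w x y x≢y p j e
  ... | k , k<j , ek = suc k , s≤s k<j , ek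

  ᵢ⇒precededBy : ∀ w x y → PrecededByᵢ w x y → PrecededBy w x y
  ᵢ⇒precededBy []      x y p = tt
  ᵢ⇒precededBy (b ∷ w) x y p with b ≟ y
  ... | yes b≡y = inj₁ b≡y
  ... | no b≢y  = inj₂ (b≢x , ᵢ⇒precededBy w x y λ j e → shift (p (suc j) e))
    where
    b≢x : b ≢ x
    b≢x b≡x with p zero b≡x
    ... | _ , () , _
    shift : ∀ {j} → ∃[ k ] (k Fin.< suc j × lookup (b ∷ w) k ≡ y) →
            ∃[ k ] (k Fin.< j × lookup w k ≡ y)
    shift (zero , _ , b≡y) = ⊥-elim (b≢y b≡y)
    shift (suc k , s≤s k<j , e) = k , k<j , e

  Separated : List (Fin n) → Fin n → Fin n → Set
  Separated []      x y = ⊤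
  Separated (a ∷ w) x y = (a ≡ x → PrecededBy w x y) × Separated w x y

  separated⇒betweenAny : ∀ w x y → x ≢ y → Separated w x y → BetweenAny w x y
  separated⇒betweenAny (a ∷ w) x y x≢y _ zero zero () _ _
  separated⇒betweenAny (a ∷ w) x y x≢y _ (suc i) zero () _ _
  separated⇒betweenAny (a ∷ w) x y x≢y (first , _) zero (suc j) _ a≡x e
    with precededBy⇒ᵢ w x y x≢y (first a≡x) j e
  ... | k , k<j , ek = suc k , s≤s z≤n , s≤s k<j , ek
  separated⇒betweenAny (a ∷ w) x y x≢y (_ , later) (suc i) (suc j) (s≤s i<j) ei ej
    with separated⇒betweenAny w x y x≢y later i j i<j ei ej
  ... | k , i<k , k<j , ek = suc k , s≤s i<k , s≤s k<j , ek

  betweenAny⇒separated : ∀ w x y → BetweenAny w x y → Separated w x y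
  betweenAny⇒separated []      x y b = tt
  betweenAny⇒separated (a ∷ w) x y b =
    (λ a≡x → ᵢ⇒precededBy w x y λ j e → fromHead (b zero (suc j) (s≤s z≤n) a≡x e)) ,
    betweenAny⇒separated w x y (λ i j i<j ei ej → fromTail (b (suc i) (suc j) (s≤s i<j) ei ej))
    where
    fromHead : ∀ {j} → ∃[ k ] (zero {n = length w} Fin.< k × k Fin.< suc j × lookup (a ∷ w) k ≡ y) →
               ∃[ k ] (k Fin.< j × lookup w k ≡ y)
    fromHead (zero , () , _)
    fromHead (suc k , _ , s≤s k<j , e) = k , k<j , e
    fromTail : ∀ {i j} → ∃[ k ] (suc i Fin.< k × k Fin.< suc j × lookup (a ∷ w) k ≡ y) →
               ∃[ k ] (i Fin.< k × k Fin.< j × lookup w k ≡ y)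
    fromTail (zero , () , _)
    fromTail (suc k , s≤s i<k , s≤s k<j , e) = k , i<k , k<j , e

  Alternating : List (Fin n) → Fin n → Fin n → Set
  Alternating w x y = Separated w x y × Separated w y x

  alternating⇒alternate : ∀ w x y → x ≢ y → Alternating w x y → Alternate w x y
  alternating⇒alternate w x y x≢y (sxy , syx) =
    separated⇒betweenAny w x y x≢y sxy , separated⇒betweenAny w y x (λ e → x≢y (sym e)) syx

  alternate⇒alternating : ∀ w x y → Alternate w x y → Alternating w x y
  alternate⇒alternating w x y (bxy , byx) =
    betweenAny⇒separated w x y bxy , betweenAny⇒separated w y x byx

-- Alternation of x and y only depends on the subword over {x, y}.

module _ {n : ℕ} where

  OneOf : Fin n → Fin n → Fin n → Set
  OneOf x y a = a ≡ x ⊎ a ≡ y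

  oneOf? : ∀ x y (a : Fin n) → Dec (OneOf x y a)
  oneOf? x y a with a ≟ x | a ≟ y
  ... | yes a≡x | _       = yes (inj₁ a≡x)
  ... | no _    | yes a≡y = yes (inj₂ a≡y)
  ... | no a≢x  | no a≢y  = no λ { (inj₁ a≡x) → a≢x a≡x ; (inj₂ a≡y) → a≢y a≡y }

  restrict : Fin n → Fin n → List (Fin n) → List (Fin n)
  restrict x y = filter (oneOf? x y)

  restrict-comm : ∀ x y w → restrict x y w ≡ restrict y x w
  restrict-comm x y = filter-≐ (oneOf? x y) (oneOf? y x) (swap , swap)

  precededBy-restrict⁺ : ∀ x y w → PrecededBy w x y → PrecededBy (restrict x y w) x y
  precededBy-restrict⁺ x y [] p = tt
  precededBy-restrict⁺ x y (b ∷ w) p with oneOf? x y b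
  precededBy-restrict⁺ x y (b ∷ w) (inj₁ b≡y)       | yes _ = inj₁ b≡y
  precededBy-restrict⁺ x y (b ∷ w) (inj₂ (b≢x , p)) | yes _ = inj₂ (b≢x , precededBy-restrict⁺ x y w p)
  precededBy-restrict⁺ x y (b ∷ w) (inj₁ b≡y)       | no b∉ = ⊥-elim (b∉ (inj₂ b≡y))
  precededBy-restrict⁺ x y (b ∷ w) (inj₂ (_ , p))   | no _  = precededBy-restrict⁺ x y w p

  precededBy-restrict⁻ : ∀ x y w → PrecededBy (restrict x y w) x y → PrecededBy w x y
  precededBy-restrict⁻ x y [] p = tt
  precededBy-restrict⁻ x y (b ∷ w) p with oneOf? x y b
  precededBy-restrict⁻ x y (b ∷ w) (inj₁ b≡y)       | yes _ = inj₁ b≡y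
  precededBy-restrict⁻ x y (b ∷ w) (inj₂ (b≢x , p)) | yes _ = inj₂ (b≢x , precededBy-restrict⁻ x y w p)
  ... | no b∉ = inj₂ ((λ b≡x → b∉ (inj₁ b≡x)) , precededBy-restrict⁻ x y w p)

  separated-restrict⁺ : ∀ x y w → Separated w x y → Separated (restrict x y w) x y
  separated-restrict⁺ x y [] s = tt
  separated-restrict⁺ x y (b ∷ w) (first , later) with oneOf? x y b
  ... | yes _ = (λ b≡x → precededBy-restrict⁺ x y w (first b≡x)) , separated-restrict⁺ x y w later
  ... | no _  = separated-restrict⁺ x y w later

  separated-restrict⁻ : ∀ x y w → Separated (restrict x y w) x y → Separated w x y
  separated-restrict⁻ x y [] s = tt
  separated-restrict⁻ x y (b ∷ w) s with oneOf? x y b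
  ... | yes _ = (λ b≡x → precededBy-restrict⁻ x y w (proj₁ s b≡x)) , separated-restrict⁻ x y w (proj₂ s)
  ... | no b∉ = (λ b≡x → ⊥-elim (b∉ (inj₁ b≡x))) , separated-restrict⁻ x y w s

  alternating-restrict⁺ : ∀ x y w → Alternating w x y → Alternating (restrict x y w) x y
  alternating-restrict⁺ x y w (sxy , syx) =
    separated-restrict⁺ x y w sxy ,
    subst (λ v → Separated v y x) (restrict-comm y x w) (separated-restrict⁺ y x w syx)

  alternating-restrict⁻ : ∀ x y w → Alternating (restrict x y w) x y → Alternating w x y
  alternating-restrict⁻ x y w (sxy , syx) =
    separated-restrict⁻ x y w sxy ,
    separated-restrict⁻ y x w (subst (λ v → Separated v y x) (restrict-comm x y w) syx)

  alternating-transfer : ∀ x y w w′ → restrict x y w ≡ restrict x y w′ →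
                         Alternating w x y → Alternating w′ x y
  alternating-transfer x y w w′ eq alt =
    alternating-restrict⁻ x y w′ (subst (λ v → Alternating v x y) eq (alternating-restrict⁺ x y w alt))

-- Occurrence counts, and wrapping a fresh letter u around a prefix:
-- the passage from  P ++ Q  to  u ∷ P ++ u ∷ Q.

module _ {n : ℕ} where

  occ-++ : ∀ (xs ys : List (Fin n)) v → occ (xs ++ ys) v ≡ occ xs v + occ ys v
  occ-++ xs ys v = trans (cong length (filter-++ (_≟ v) xs ys)) (length-++ (filter (_≟ v) xs))

  occ-hit : ∀ (L : List (Fin n)) {a v} → a ≡ v → occ (a ∷ L) v ≡ suc (occ L v)
  occ-hit L {v = v} a≡v = cong length (filter-accept (_≟ v) a≡v)

  occ-miss : ∀ (L : List (Fin n)) {a v} → a ≢ v → occ (a ∷ L) v ≡ occ L v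
  occ-miss L {v = v} a≢v = cong length (filter-reject (_≟ v) a≢v)

  occ-wrap-fresh : ∀ u P Q → occ (P ++ Q) u ≡ 0 → occ (u ∷ P ++ u ∷ Q) u ≡ 2
  occ-wrap-fresh u P Q none = begin
    occ (u ∷ P ++ u ∷ Q) u       ≡⟨ occ-hit (P ++ u ∷ Q) refl ⟩
    suc (occ (P ++ u ∷ Q) u)     ≡⟨ cong suc (occ-++ P (u ∷ Q) u) ⟩
    suc (occ P u + occ (u ∷ Q) u) ≡⟨ cong (λ m → suc (occ P u + m)) (occ-hit Q refl) ⟩
    suc (occ P u + suc (occ Q u)) ≡⟨ cong suc (ℕP.+-suc (occ P u) (occ Q u)) ⟩
    suc (suc (occ P u + occ Q u)) ≡⟨ cong (λ m → suc (suc m)) (trans (sym (occ-++ P Q u)) none) ⟩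
    2                             ∎
    where open ≡-Reasoning

  occ-wrap-other : ∀ u P Q {z} → z ≢ u → occ (u ∷ P ++ u ∷ Q) z ≡ occ (P ++ Q) z
  occ-wrap-other u P Q {z} z≢u = begin
    occ (u ∷ P ++ u ∷ Q) z   ≡⟨ occ-miss (P ++ u ∷ Q) u≢z ⟩
    occ (P ++ u ∷ Q) z       ≡⟨ occ-++ P (u ∷ Q) z ⟩
    occ P z + occ (u ∷ Q) z  ≡⟨ cong (occ P z +_) (occ-miss Q u≢z) ⟩
    occ P z + occ Q z        ≡⟨ sym (occ-++ P Q z) ⟩
    occ (P ++ Q) z           ∎
    where
    open ≡-Reasoning
    u≢z : u ≢ z
    u≢z u≡z = z≢u (sym u≡z)

  restrict-miss : ∀ x y {u : Fin n} L → u ≢ x → u ≢ y → restrict x y (u ∷ L) ≡ restrict x y L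
  restrict-miss x y L u≢x u≢y =
    filter-reject (oneOf? x y) λ { (inj₁ u≡x) → u≢x u≡x ; (inj₂ u≡y) → u≢y u≡y }

  restrict-wrap-other : ∀ x y u P Q → x ≢ u → y ≢ u →
                        restrict x y (u ∷ P ++ u ∷ Q) ≡ restrict x y (P ++ Q)
  restrict-wrap-other x y u P Q x≢u y≢u = begin
    restrict x y (u ∷ P ++ u ∷ Q)             ≡⟨ restrict-miss x y (P ++ u ∷ Q) u≢x u≢y ⟩
    restrict x y (P ++ u ∷ Q)                 ≡⟨ filter-++ (oneOf? x y) P (u ∷ Q) ⟩
    restrict x y P ++ restrict x y (u ∷ Q)    ≡⟨ cong (restrict x y P ++_) (restrict-miss x y Q u≢x u≢y) ⟩
    restrict x y P ++ restrict x y Q          ≡⟨ filter-++ (oneOf? x y) P Q ⟨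
    restrict x y (P ++ Q)                     ∎
    where
    open ≡-Reasoning
    u≢x : u ≢ x
    u≢x e = x≢u (sym e)
    u≢y : u ≢ y
    u≢y e = y≢u (sym e)

  restrict-absent : ∀ (u y : Fin n) L → All (_≢ u) L → restrict u y L ≡ replicate (occ L y) y
  restrict-absent u y []      []            = refl
  restrict-absent u y (a ∷ L) (a≢u ∷ L∌u) = byCase (a ≟ y)
    where
    open ≡-Reasoning
    byCase : Dec (a ≡ y) → restrict u y (a ∷ L) ≡ replicate (occ (a ∷ L) y) y
    byCase (yes a≡y) = begin
      restrict u y (a ∷ L)         ≡⟨ filter-accept (oneOf? u y) (inj₂ a≡y) ⟩
      a ∷ restrict u y L           ≡⟨ cong₂ _∷_ a≡y (restrict-absent u y L L∌u) ⟩
      replicate (suc (occ L y)) y  ≡⟨ cong (λ m → replicate m y) (occ-hit L a≡y) ⟨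
      replicate (occ (a ∷ L) y) y  ∎
    byCase (no a≢y) = begin
      restrict u y (a ∷ L)         ≡⟨ restrict-miss u y L a≢u a≢y ⟩
      restrict u y L               ≡⟨ restrict-absent u y L L∌u ⟩
      replicate (occ L y) y        ≡⟨ cong (λ m → replicate m y) (occ-miss L a≢y) ⟨
      replicate (occ (a ∷ L) y) y  ∎

  restrict-wrap-self : ∀ u y P Q → All (_≢ u) P → All (_≢ u) Q →
    restrict u y (u ∷ P ++ u ∷ Q) ≡ u ∷ replicate (occ P y) y ++ u ∷ replicate (occ Q y) y
  restrict-wrap-self u y P Q P∌u Q∌u = begin
    restrict u y (u ∷ P ++ u ∷ Q)                ≡⟨ filter-accept (oneOf? u y) (inj₁ refl) ⟩
    u ∷ restrict u y (P ++ u ∷ Q)                ≡⟨ cong (u ∷_) (filter-++ (oneOf? u y) P (u ∷ Q)) ⟩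
    u ∷ restrict u y P ++ restrict u y (u ∷ Q)   ≡⟨ cong (λ v → u ∷ restrict u y P ++ v) (filter-accept (oneOf? u y) (inj₁ refl)) ⟩
    u ∷ restrict u y P ++ u ∷ restrict u y Q     ≡⟨ cong₂ (λ v v′ → u ∷ v ++ u ∷ v′) (restrict-absent u y P P∌u) (restrict-absent u y Q Q∌u) ⟩
    u ∷ replicate (occ P y) y ++ u ∷ replicate (occ Q y) y ∎
    where open ≡-Reasoning

  wrap-alternating : ∀ u y P Q → u ≢ y → All (_≢ u) P → All (_≢ u) Q →
                     occ P y ≡ 1 → occ Q y ≡ 1 → Alternating (u ∷ P ++ u ∷ Q) u y
  wrap-alternating u y P Q u≢y P∌u Q∌u P₁ Q₁ =
    alternating-restrict⁻ u y (u ∷ P ++ u ∷ Q)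
      (subst (λ v → Alternating v u y) (sym restricted) uyuy)
    where
    restricted : restrict u y (u ∷ P ++ u ∷ Q) ≡ u ∷ y ∷ u ∷ y ∷ []
    restricted = trans (restrict-wrap-self u y P Q P∌u Q∌u)
                       (cong₂ (λ i j → u ∷ replicate i y ++ u ∷ replicate j y) P₁ Q₁)
    y≢u : y ≢ u
    y≢u e = u≢y (sym e)
    uyuy : Alternating (u ∷ y ∷ u ∷ y ∷ []) u y
    uyuy = ((λ _ → inj₁ refl) , (λ y≡u → ⊥-elim (y≢u y≡u)) , (λ _ → inj₁ refl) , (λ y≡u → ⊥-elim (y≢u y≡u)) , tt)
         , ((λ u≡y → ⊥-elim (u≢y u≡y)) , (λ _ → inj₁ refl) , (λ u≡y → ⊥-elim (u≢y u≡y)) , (λ _ → tt) , tt)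

  wrap-not-alternating : ∀ u y P Q → u ≢ y → All (_≢ u) P → All (_≢ u) Q →
                         occ P y + occ Q y ≡ 2 → occ P y ≡ 0 ⊎ occ P y ≡ 2 →
                         ¬ Alternating (u ∷ P ++ u ∷ Q) u y
  wrap-not-alternating u y P Q u≢y P∌u Q∌u total parity alt =
    refute parity (subst (λ v → Alternating v u y) (restrict-wrap-self u y P Q P∌u Q∌u)
                         (alternating-restrict⁺ u y (u ∷ P ++ u ∷ Q) alt))
    where
    shape : ∀ {i j} → occ P y ≡ i → occ Q y ≡ j →
            Alternating (u ∷ replicate (occ P y) y ++ u ∷ replicate (occ Q y) y) u y →
            Alternating (u ∷ replicate i y ++ u ∷ replicate j y) u y
    shape P≡ Q≡ = subst (λ v → Alternating v u y) (cong₂ (λ i j → u ∷ replicate i y ++ u ∷ replicate j y) P≡ Q≡)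
    refute : occ P y ≡ 0 ⊎ occ P y ≡ 2 →
             ¬ Alternating (u ∷ replicate (occ P y) y ++ u ∷ replicate (occ Q y) y) u y
    -- in  u u y y  the two u's are not separated by y
    refute (inj₁ P₀) alt with shape P₀ (trans (cong (_+ occ Q y) (sym P₀)) total) alt
    ... | (sep , _) , _ with sep refl
    ...   | inj₁ u≡y = u≢y u≡y
    ...   | inj₂ (u≢u , _) = u≢u refl
    -- in  u y y u  the two y's are not separated by u
    refute (inj₂ P₂) alt with shape P₂ (ℕP.+-cancelˡ-≡ 2 _ 0 (trans (cong (_+ occ Q y) (sym P₂)) total)) alt
    ... | _ , (_ , sep , _) with sep refl
    ...   | inj₁ y≡u = u≢y (sym y≡u)
    ...   | inj₂ (y≢y , _) = y≢y refl

-- A 132 pattern starting with the value x is exactly a failure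
-- of  AboveIncreasing x 0  on the rest of the word.
AboveIncreasing : ℕ → ℕ → List ℕ → Set
AboveIncreasing x m []      = ⊤
AboveIncreasing x m (b ∷ w) = (x < b × m ≤ b × AboveIncreasing x b w) ⊎ (b ≤ x × AboveIncreasing x m w)

Avoids132ᵢ : List ℕ → Set
Avoids132ᵢ []      = ⊤
Avoids132ᵢ (b ∷ w) = AboveIncreasing b 0 w × Avoids132ᵢ w

aboveIncreasing-lower : ∀ x m w → AboveIncreasing x m w →
  (j : Fin (length w)) → x < lookup w j → m ≤ lookup w j
aboveIncreasing-lower x m (b ∷ w) (inj₁ (_ , m≤b , _)) zero    _   = m≤b
aboveIncreasing-lower x m (b ∷ w) (inj₂ (b≤x , _))     zero    x<b = ⊥-elim (ℕP.≤⇒≯ b≤x x<b)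
aboveIncreasing-lower x m (b ∷ w) (inj₁ (_ , m≤b , h)) (suc j) x<c = ℕP.≤-trans m≤b (aboveIncreasing-lower x b w h j x<c)
aboveIncreasing-lower x m (b ∷ w) (inj₂ (_ , h))       (suc j) x<c = aboveIncreasing-lower x m w h j x<c

aboveIncreasing-sorted : ∀ x m w → AboveIncreasing x m w → (j l : Fin (length w)) → j Fin.< l →
  x < lookup w j → x < lookup w l → lookup w j ≤ lookup w l
aboveIncreasing-sorted x m (b ∷ w) h zero zero () _ _
aboveIncreasing-sorted x m (b ∷ w) h (suc j) zero () _ _
aboveIncreasing-sorted x m (b ∷ w) (inj₁ (_ , _ , h)) zero (suc l) _ _ x<l = aboveIncreasing-lower x b w h l x<l
aboveIncreasing-sorted x m (b ∷ w) (inj₂ (b≤x , _)) zero (suc l) _ x<b _ = ⊥-elim (ℕP.≤⇒≯ b≤x x<b)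
aboveIncreasing-sorted x m (b ∷ w) (inj₁ (_ , _ , h)) (suc j) (suc l) (s≤s j<l) =
  aboveIncreasing-sorted x b w h j l j<l
aboveIncreasing-sorted x m (b ∷ w) (inj₂ (_ , h)) (suc j) (suc l) (s≤s j<l) =
  aboveIncreasing-sorted x m w h j l j<l

avoids132ᵢ⇒avoids132 : ∀ w → Avoids132ᵢ w → Avoids132 w
avoids132ᵢ⇒avoids132 (b ∷ w) _ (zero , zero , _ , () , _)
avoids132ᵢ⇒avoids132 (b ∷ w) _ (zero , suc j , zero , _ , () , _)
avoids132ᵢ⇒avoids132 (b ∷ w) (h , _) (zero , suc j , suc l , _ , s≤s j<l , b<wl , wl<wj) =
  ℕP.<-irrefl refl (ℕP.≤-<-trans (aboveIncreasing-sorted b 0 w h j l j<l (ℕP.<-trans b<wl wl<wj) b<wl) wl<wj)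
avoids132ᵢ⇒avoids132 (b ∷ w) _ (suc i , zero , _ , () , _)
avoids132ᵢ⇒avoids132 (b ∷ w) _ (suc i , suc j , zero , _ , () , _)
avoids132ᵢ⇒avoids132 (b ∷ w) (_ , h) (suc i , suc j , suc l , s≤s i<j , s≤s j<l , p) =
  avoids132ᵢ⇒avoids132 w h (i , j , l , i<j , j<l , p)

aboveIncreasing-none : ∀ x m w → All (_≤ x) w → AboveIncreasing x m w
aboveIncreasing-none x m []      []          = tt
aboveIncreasing-none x m (b ∷ w) (b≤x ∷ w≤x) = inj₂ (b≤x , aboveIncreasing-none x m w w≤x)

aboveIncreasing-insert : ∀ x m M P Q → AboveIncreasing x m (P ++ Q) →
  All (_≤ M) P → m ≤ M → All (_≤ x) Q → AboveIncreasing x m (P ++ M ∷ Q)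
aboveIncreasing-insert x m M [] Q h _ m≤M Q≤x with x ℕP.<? M
... | yes x<M = inj₁ (x<M , m≤M , aboveIncreasing-none x M Q Q≤x)
... | no x≮M  = inj₂ (ℕP.≮⇒≥ x≮M , h)
aboveIncreasing-insert x m M (b ∷ P) Q (inj₁ (x<b , m≤b , h)) (b≤M ∷ P≤M) m≤M Q≤x =
  inj₁ (x<b , m≤b , aboveIncreasing-insert x b M P Q h P≤M b≤M Q≤x)
aboveIncreasing-insert x m M (b ∷ P) Q (inj₂ (b≤x , h)) (_ ∷ P≤M) m≤M Q≤x =
  inj₂ (b≤x , aboveIncreasing-insert x m M P Q h P≤M m≤M Q≤x)

Dominates : List ℕ → List ℕ → Set
Dominates P Q = All (λ q → All (q ≤_) P) Q

avoids132-insert : ∀ M P Q → Avoids132ᵢ (P ++ Q) → All (_≤ M) P → All (_≤ M) Q →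
                   Dominates P Q → Avoids132ᵢ (P ++ M ∷ Q)
avoids132-insert M []      Q h _ Q≤M _ = aboveIncreasing-none M 0 Q Q≤M , h
avoids132-insert M (p ∷ P) Q (hp , h) (p≤M ∷ P≤M) Q≤M dom =
  aboveIncreasing-insert p 0 M P Q hp P≤M z≤n (All.map All.head dom) ,
  avoids132-insert M P Q h P≤M Q≤M (All.map All.tail dom)

-- The key step of the construction: wrapping a new maximum M around a
-- prefix P that dominates the rest Q keeps a word 132-avoiding, because M
-- can only play the role of the 3, and no earlier entry is below a later one.
avoids132-wrapMax : ∀ M P Q → Avoids132ᵢ (P ++ Q) → All (_≤ M) P → All (_≤ M) Q →
                    Dominates P Q → Avoids132ᵢ (M ∷ P ++ M ∷ Q)
avoids132-wrapMax M P Q h P≤M Q≤M dom =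
  aboveIncreasing-none M 0 (P ++ M ∷ Q) (AllP.++⁺ P≤M (ℕP.≤-refl ∷ Q≤M)) ,
  avoids132-insert M P Q h P≤M Q≤M dom

-- A stack entry (a , X) records a vertex a whose
-- neighbours may still be unexplored together with its block X of the word;
-- the word of a stack is the concatenation of its blocks followed by r.

Entry : ℕ → Set
Entry n = Fin n × List (Fin n)

module Search {n : ℕ} (G : Graph n) (acyclic : Acyclic G) (r : Fin n) where

  edge-sym : ∀ {x y} → Edge G x y → Edge G y x
  edge-sym {x} {y} e = trans (adj-sym G y x) e

  data Path : Fin n → Fin n → List (Fin n) → Set where
    one  : ∀ a → Path a a (a ∷ [])
    cons : ∀ {a b c L} → Edge G a b → Path b c L → Path a c (a ∷ L)

  path-snoc : ∀ {a b L u} → Path a b L → Edge G b u → Path a u (L ∷ʳ u)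
  path-snoc (one a)     e = cons e (one _)
  path-snoc (cons e′ p) e = cons e′ (path-snoc p e)

  path-chain-snoc : ∀ {a b L u} → Path a b L → Edge G b u → Chain G (L ∷ʳ u)
  path-chain-snoc (one a)                    e = e , tt
  path-chain-snoc (cons e′ (one b))          e = e′ , e , tt
  path-chain-snoc (cons e′ (cons e″ p))      e = e′ , path-chain-snoc (cons e″ p) e

  path-length : ∀ {a b L} → Path a b L → a ≢ b → 2 ≤ length L
  path-length (one a)               a≢a = ⊥-elim (a≢a refl)
  path-length (cons e (one _))      _   = s≤s (s≤s z≤n)
  path-length (cons e (cons e′ p))  _   = s≤s (s≤s z≤n)

  -- In a forest, a vertex u outside a simple path from a to b ≠ a cannot
  -- be adjacent to both ends: that would close a cycle.
  unique-attachment : ∀ {a b L u} → Path a b L → AllPairs _≢_ L → All (_≢ u) L → a ≢ b →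
                      Edge G a u → Edge G b u → ⊥
  unique-attachment (one _) _ _ a≢a _ _ = a≢a refl
  unique-attachment {a} {L = a ∷ L′} {u} p@(cons e q) distinct L∌u a≢b a–u b–u =
    acyclic (u ∷ a ∷ L′)
      ( s≤s (path-length p a≢b)
      , All.map (λ z≢u u≡z → z≢u (sym u≡z)) L∌u ∷ distinct
      , edge-sym a–u , path-chain-snoc p b–u )

  word : List (Entry n) → List (Fin n)
  word []             = r ∷ []
  word ((a , X) ∷ st) = X ++ word st

  blocks : List (Entry n) → List (Fin n)
  blocks []             = []
  blocks ((a , X) ∷ st) = X ++ blocks st

  word-split : ∀ top (e : Entry n) rest → word (top ++ e ∷ rest) ≡ (blocks top ++ proj₂ e) ++ word rest
  word-split []             (a , X) rest = refl
  word-split ((b , Y) ∷ top) (a , X) rest = begin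
    Y ++ word (top ++ (a , X) ∷ rest)         ≡⟨ cong (Y ++_) (word-split top (a , X) rest) ⟩
    Y ++ (blocks top ++ X) ++ word rest       ≡⟨ ++-assoc Y (blocks top ++ X) (word rest) ⟨
    (Y ++ blocks top ++ X) ++ word rest       ≡⟨ cong (_++ word rest) (++-assoc Y (blocks top) X) ⟨
    ((Y ++ blocks top) ++ X) ++ word rest     ∎
    where open ≡-Reasoning

  blocks-++ : ∀ A B → blocks (A ++ B) ≡ blocks A ++ blocks B
  blocks-++ []             B = refl
  blocks-++ ((b , Y) ∷ A) B = trans (cong (Y ++_) (blocks-++ A B)) (sym (++-assoc Y (blocks A) (blocks B)))

  -- The prefix P of the word up to the end of a's block contains a once
  -- and every other letter 0 or 2 times; a letter wrapped around P will
  -- thus alternate with a only.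
  CutsOnce : Fin n → List (Fin n) → Set
  CutsOnce a P = occ P a ≡ 1 × (∀ z → z ≢ a → occ P z ≡ 0 ⊎ occ P z ≡ 2)

  LabelDominates : (Fin n → ℕ) → List (Fin n) → List (Fin n) → Set
  LabelDominates lab P Q = All (λ q → All (λ p → lab q ≤ lab p) P) Q

  labelDominates⇒dominates : ∀ lab P Q → LabelDominates lab P Q → Dominates (map lab P) (map lab Q)
  labelDominates⇒dominates lab P Q dom = AllP.map⁺ (All.map AllP.map⁺ dom)

  -- every stack entry cuts the word so that the new maximum can be wrapped
  -- around the prefix ending with its block
  WellStacked : (Fin n → ℕ) → List (Entry n) → Set
  WellStacked lab st = ∀ top a X rest → st ≡ top ++ (a , X) ∷ rest →
    CutsOnce a (blocks top ++ X) × LabelDominates lab (blocks top ++ X) (word rest)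

  wrap-assoc : ∀ (u : Fin n) P R → u ∷ ((P ∷ʳ u) ++ R) ≡ u ∷ P ++ u ∷ R
  wrap-assoc u P R = cong (u ∷_) (++-assoc P (u ∷ []) R)

  cutsOnce-wrap : ∀ a u P R → a ≢ u → occ (P ++ R) u ≡ 0 → CutsOnce a (P ++ R) →
                  CutsOnce a (u ∷ P ++ u ∷ R)
  cutsOnce-wrap a u P R a≢u R∌u (once , others) =
    trans (occ-wrap-other u P R a≢u) once , others′
    where
    others′ : ∀ z → z ≢ a → occ (u ∷ P ++ u ∷ R) z ≡ 0 ⊎ occ (u ∷ P ++ u ∷ R) z ≡ 2
    others′ z z≢a with z ≟ u
    ... | yes refl = inj₂ (occ-wrap-fresh u P R R∌u)
    ... | no z≢u rewrite occ-wrap-other u P R z≢u = others z z≢a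

  all-wrap : ∀ {Pr : Fin n → Set} u P R → Pr u → All Pr (P ++ R) → All Pr (u ∷ ((P ∷ʳ u) ++ R))
  all-wrap u P R pu h with AllP.++⁻ P h
  ... | hP , hR = pu ∷ AllP.++⁺ (AllP.++⁺ hP (pu ∷ [])) hR

  update : ∀ {A : Set} → (Fin n → A) → Fin n → A → Fin n → A
  update f u v z = if does (z ≟ u) then v else f z

  update-here : ∀ {A : Set} (f : Fin n → A) u v → update f u v u ≡ v
  update-here f u v with u ≟ u
  ... | yes _   = refl
  ... | no u≢u  = ⊥-elim (u≢u refl)

  update-there : ∀ {A : Set} (f : Fin n → A) u v {z} → z ≢ u → update f u v z ≡ f z
  update-there f u v {z} z≢u with z ≟ u
  ... | yes z≡u = ⊥-elim (z≢u z≡u)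
  ... | no _    = refl

  map-update : ∀ {A : Set} (f : Fin n → A) u v L → All (_≢ u) L → map (update f u v) L ≡ map f L
  map-update f u v []      []            = refl
  map-update f u v (z ∷ L) (z≢u ∷ L∌u) = cong₂ _∷_ (update-there f u v z≢u) (map-update f u v L L∌u)

  labelDominates-wrap : ∀ lab u k P R S → LabelDominates lab (P ++ R) S → All (_≢ u) (P ++ R) →
    All (λ q → q ≢ u × lab q < k) S → LabelDominates (update lab u k) (u ∷ ((P ∷ʳ u) ++ R)) S
  labelDominates-wrap lab u k P R S dom PR∌u S-info = All.zipWith below (dom , S-info)
    where
    below : ∀ {q} → All (λ p → lab q ≤ lab p) (P ++ R) × (q ≢ u × lab q < k) →
            All (λ p → update lab u k q ≤ update lab u k p) (u ∷ ((P ∷ʳ u) ++ R))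
    below {q} (q≤PR , q≢u , q<k) rewrite update-there lab u k q≢u =
      all-wrap u P R (subst (lab q ≤_) (sym (update-here lab u k)) (ℕP.<⇒≤ q<k))
        (All.zipWith (λ { {p} (q≤p , p≢u) → subst (lab q ≤_) (sym (update-there lab u k p≢u)) q≤p })
                     (q≤PR , PR∌u))

  -- the stack after discovering u from a: u gets a singleton block, the
  -- finished entries above a are popped and merged into a's block
  wellStacked-push : ∀ lab u a P rest →
    CutsOnce u (u ∷ []) → LabelDominates lab (u ∷ []) ((P ∷ʳ u) ++ word rest) →
    CutsOnce a (u ∷ (P ∷ʳ u)) → LabelDominates lab (u ∷ (P ∷ʳ u)) (word rest) →
    (∀ top a′ X′ rest′ → rest ≡ top ++ (a′ , X′) ∷ rest′ →
       CutsOnce a′ (u ∷ ((P ∷ʳ u) ++ (blocks top ++ X′))) ×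
       LabelDominates lab (u ∷ ((P ∷ʳ u) ++ (blocks top ++ X′))) (word rest′)) →
    WellStacked lab ((u , u ∷ []) ∷ (a , P ∷ʳ u) ∷ rest)
  wellStacked-push lab u a P rest cu du _ _ _ [] _ _ _ refl = cu , du
  wellStacked-push lab u a P rest _ _ ca da _ (_ ∷ []) _ _ _ refl = ca , da
  wellStacked-push lab u a P .(top ++ (a′ , X′) ∷ rest′) _ _ _ _ deeper (_ ∷ _ ∷ top) a′ X′ rest′ refl =
    subst (λ L → CutsOnce a′ L × LabelDominates lab L (word rest′))
          (sym (cong (u ∷_) (++-assoc (P ∷ʳ u) (blocks top) X′)))
          (deeper top a′ X′ rest′ refl)

  Explored : (Fin n → Bool) → Fin n → Set
  Explored vis z = vis z ≡ true

  OnStack : Fin n → List (Entry n) → Set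
  OnStack z st = Any (λ e → z ≡ proj₁ e) st

  Done : (Fin n → Bool) → Entry n → Set
  Done vis e = ∀ w → Edge G (proj₁ e) w → Explored vis w

  record State : Set where
    constructor mkState
    field
      vis   : Fin n → Bool
      k     : ℕ
      lab   : Fin n → ℕ
      st    : List (Entry n)

  RepresentsOn : (Fin n → Bool) → List (Fin n) → Set
  RepresentsOn vis w = ∀ x y → Explored vis x → Explored vis y → x ≢ y →
    (Alternating w x y → Edge G x y) × (Edge G x y → Alternating w x y)

  record Invariant (S : State) : Set where
    open State S
    field
      twice        : ∀ z → Explored vis z → occ (word st) z ≡ 2
      absent       : ∀ z → vis z ≡ false → occ (word st) z ≡ 0
      letters      : All (Explored vis) (word st)
      represents   : RepresentsOn vis (word st)
      avoids       : Avoids132ᵢ (map lab (word st))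
      stacked      : WellStacked lab st
      onStack      : All (λ e → Explored vis (proj₁ e)) st
      labelBound   : ∀ z → Explored vis z → lab z < k
      injective    : ∀ x y → Explored vis x → Explored vis y → lab x ≡ lab y → x ≡ y
      finished     : ∀ z u → Explored vis z → ¬ OnStack z st → Edge G z u → Explored vis u
      connected    : ∀ a b → Explored vis a → Explored vis b →
                     ∃ λ L → Path a b L × AllPairs _≢_ L × All (Explored vis) L
      rootExplored : Explored vis r

  module Discover (vis : Fin n → Bool) (k : ℕ) (lab : Fin n → ℕ) (st : List (Entry n))
                  (I : Invariant (mkState vis k lab st))
                  (top : List (Entry n)) (a : Fin n) (X : List (Fin n)) (rest : List (Entry n))
                  (split : st ≡ top ++ (a , X) ∷ rest) (topDone : All (Done vis) top)
                  (u : Fin n) (a–u : Edge G a u) (u-new : vis u ≡ false) where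
    open Invariant I

    P Q : List (Fin n)
    P = blocks top ++ X
    Q = word rest

    vis′ : Fin n → Bool
    vis′ = update vis u true

    lab′ : Fin n → ℕ
    lab′ = update lab u k

    st′ : List (Entry n)
    st′ = (u , u ∷ []) ∷ (a , P ∷ʳ u) ∷ rest

    word≡ : word st ≡ P ++ Q
    word≡ = trans (cong word split) (word-split top (a , X) rest)

    word′≡ : word st′ ≡ u ∷ P ++ u ∷ Q
    word′≡ = wrap-assoc u P Q

    explored≢u : ∀ {z} → Explored vis z → z ≢ u
    explored≢u vz refl with trans (sym vz) u-new
    ... | ()

    explored-keep : ∀ {z} → Explored vis z → Explored vis′ z
    explored-keep vz = trans (update-there vis u true (explored≢u vz)) vz

    explored-back : ∀ {z} → Explored vis′ z → z ≢ u → Explored vis z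
    explored-back v′z z≢u = trans (sym (update-there vis u true z≢u)) v′z

    PQ-explored : All (Explored vis) (P ++ Q)
    PQ-explored = subst (All (Explored vis)) word≡ letters

    P-explored : All (Explored vis) P
    P-explored = AllP.++⁻ˡ P PQ-explored

    Q-explored : All (Explored vis) Q
    Q-explored = AllP.++⁻ʳ P PQ-explored

    P∌u : All (_≢ u) P
    P∌u = All.map explored≢u P-explored

    Q∌u : All (_≢ u) Q
    Q∌u = All.map explored≢u Q-explored

    split-explored : All (λ e → Explored vis (proj₁ e)) (top ++ (a , X) ∷ rest)
    split-explored = subst (All (λ e → Explored vis (proj₁ e))) split onStack

    a-explored : Explored vis a
    a-explored = All.head (AllP.++⁻ʳ top split-explored)

    a≢u : a ≢ u
    a≢u = explored≢u a-explored

    cuts : CutsOnce a P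
    cuts = proj₁ (stacked top a X rest split)

    dominates : LabelDominates lab P Q
    dominates = proj₂ (stacked top a X rest split)

    occ≡ : ∀ z → occ (P ++ Q) z ≡ occ (word st) z
    occ≡ z = cong (λ L → occ L z) (sym word≡)

    PQ-no-u : occ (P ++ Q) u ≡ 0
    PQ-no-u = trans (occ≡ u) (absent u u-new)

    occ′≡ : ∀ z → occ (word st′) z ≡ occ (u ∷ P ++ u ∷ Q) z
    occ′≡ z = cong (λ L → occ L z) word′≡

    twice′ : ∀ z → Explored vis′ z → occ (word st′) z ≡ 2
    twice′ z v′z = trans (occ′≡ z) (byCase (z ≟ u))
      where
      byCase : Dec (z ≡ u) → occ (u ∷ P ++ u ∷ Q) z ≡ 2
      byCase (yes refl) = occ-wrap-fresh u P Q PQ-no-u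
      byCase (no z≢u)   = trans (occ-wrap-other u P Q z≢u) (trans (occ≡ z) (twice z (explored-back v′z z≢u)))

    absent′ : ∀ z → vis′ z ≡ false → occ (word st′) z ≡ 0
    absent′ z nz = trans (occ′≡ z) (byCase (z ≟ u))
      where
      byCase : Dec (z ≡ u) → occ (u ∷ P ++ u ∷ Q) z ≡ 0
      byCase (yes refl) with trans (sym (update-here vis u true)) nz
      ... | ()
      byCase (no z≢u) =
        trans (occ-wrap-other u P Q z≢u) (trans (occ≡ z) (absent z (trans (sym (update-there vis u true z≢u)) nz)))

    letters′ : All (Explored vis′) (word st′)
    letters′ = all-wrap u P Q (update-here vis u true) (All.map explored-keep PQ-explored)

    occ-split : ∀ y → Explored vis y → occ P y + occ Q y ≡ 2
    occ-split y vy = trans (sym (occ-++ P Q y)) (trans (occ≡ y) (twice y vy))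

    -- by acyclicity, a is the only explored neighbour of u
    attached-only-to-a : ∀ y → Explored vis y → y ≢ a → ¬ Edge G u y
    attached-only-to-a y vy y≢a u–y with connected a y a-explored vy
    ... | L , path , distinct , L-explored =
      unique-attachment path distinct (All.map explored≢u L-explored) (λ a≡y → y≢a (sym a≡y)) a–u (edge-sym u–y)

    represents-u : ∀ y → Explored vis y →
      (Alternating (word st′) u y → Edge G u y) × (Edge G u y → Alternating (word st′) u y)
    represents-u y vy = byCase (y ≟ a)
      where
      u≢y : u ≢ y
      u≢y u≡y = explored≢u vy (sym u≡y)
      toWord′ : Alternating (u ∷ P ++ u ∷ Q) u y → Alternating (word st′) u y
      toWord′ = subst (λ L → Alternating L u y) (sym word′≡)
      fromWord′ : Alternating (word st′) u y → Alternating (u ∷ P ++ u ∷ Q) u y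
      fromWord′ = subst (λ L → Alternating L u y) word′≡
      byCase : Dec (y ≡ a) →
        (Alternating (word st′) u y → Edge G u y) × (Edge G u y → Alternating (word st′) u y)
      byCase (yes refl) = (λ _ → edge-sym a–u) , (λ _ → toWord′ (wrap-alternating u y P Q u≢y P∌u Q∌u P₁ Q₁))
        where
        P₁ : occ P y ≡ 1
        P₁ = proj₁ cuts
        Q₁ : occ Q y ≡ 1
        Q₁ = ℕP.+-cancelˡ-≡ 1 _ _ (trans (cong (_+ occ Q y) (sym P₁)) (occ-split y vy))
      byCase (no y≢a) =
        (λ alt → ⊥-elim (wrap-not-alternating u y P Q u≢y P∌u Q∌u (occ-split y vy) (proj₂ cuts y y≢a) (fromWord′ alt))) ,
        (λ u–y → ⊥-elim (attached-only-to-a y vy y≢a u–y))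

    alternating-old : ∀ x y → x ≢ u → y ≢ u → restrict x y (word st′) ≡ restrict x y (word st)
    alternating-old x y x≢u y≢u =
      trans (cong (restrict x y) word′≡)
            (trans (restrict-wrap-other x y u P Q x≢u y≢u) (cong (restrict x y) (sym word≡)))

    represents′ : RepresentsOn vis′ (word st′)
    represents′ x y v′x v′y x≢y = byCase (x ≟ u) (y ≟ u)
      where
      byCase : Dec (x ≡ u) → Dec (y ≡ u) →
        (Alternating (word st′) x y → Edge G x y) × (Edge G x y → Alternating (word st′) x y)
      byCase (yes refl) (yes refl) = ⊥-elim (x≢y refl)
      byCase (yes refl) (no y≢u)   = represents-u y (explored-back v′y y≢u)
      byCase (no x≢u)   (yes refl) with represents-u x (explored-back v′x x≢u)
      ... | toEdge , toAlt = (λ (sxy , syx) → edge-sym (toEdge (syx , sxy))) ,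
                             (λ e → let (sux , sxu) = toAlt (edge-sym e) in sxu , sux)
      byCase (no x≢u)   (no y≢u)   with represents x y (explored-back v′x x≢u) (explored-back v′y y≢u) x≢y
      ... | toEdge , toAlt =
        (λ alt → toEdge (alternating-transfer x y (word st′) (word st) (alternating-old x y x≢u y≢u) alt)) ,
        (λ e → alternating-transfer x y (word st) (word st′) (sym (alternating-old x y x≢u y≢u)) (toAlt e))

    labels≤k : ∀ {L} → All (Explored vis) L → All (_≤ k) (map lab L)
    labels≤k L-explored = AllP.map⁺ (All.map (λ {z} vz → ℕP.<⇒≤ (labelBound z vz)) L-explored)

    labels′≡ : map lab′ (word st′) ≡ k ∷ map lab P ++ k ∷ map lab Q
    labels′≡ = begin
      map lab′ (word st′)                          ≡⟨ cong (map lab′) word′≡ ⟩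
      lab′ u ∷ map lab′ (P ++ u ∷ Q)               ≡⟨ cong (lab′ u ∷_) (map-++ lab′ P (u ∷ Q)) ⟩
      lab′ u ∷ map lab′ P ++ lab′ u ∷ map lab′ Q   ≡⟨ cong₂ (λ i L → i ∷ L ++ i ∷ map lab′ Q) (update-here lab u k) (map-update lab u k P P∌u) ⟩
      k ∷ map lab P ++ k ∷ map lab′ Q              ≡⟨ cong (λ L → k ∷ map lab P ++ k ∷ L) (map-update lab u k Q Q∌u) ⟩
      k ∷ map lab P ++ k ∷ map lab Q               ∎
      where open ≡-Reasoning

    avoids′ : Avoids132ᵢ (map lab′ (word st′))
    avoids′ = subst Avoids132ᵢ (sym labels′≡)
      (avoids132-wrapMax k (map lab P) (map lab Q)
        (subst Avoids132ᵢ (trans (cong (map lab) word≡) (map-++ lab P Q)) avoids)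
        (labels≤k P-explored) (labels≤k Q-explored) (labelDominates⇒dominates lab P Q dominates))

    cuts-u : CutsOnce u (u ∷ [])
    cuts-u = occ-hit [] {u} refl , λ z z≢u → inj₁ (occ-miss [] (λ u≡z → z≢u (sym u≡z)))

    below-u : ∀ {q} → Explored vis q → All (λ p → lab′ q ≤ lab′ p) (u ∷ [])
    below-u {q} vq = subst₂ _≤_ (sym (update-there lab u k (explored≢u vq))) (sym (update-here lab u k))
                            (ℕP.<⇒≤ (labelBound q vq)) ∷ []

    dominates-u : LabelDominates lab′ (u ∷ []) ((P ∷ʳ u) ++ Q)
    dominates-u = AllP.++⁺ (AllP.++⁺ (All.map below-u P-explored) ((ℕP.≤-refl ∷ []) ∷ [])) (All.map below-u Q-explored)

    cuts-a : CutsOnce a (u ∷ (P ∷ʳ u))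
    cuts-a = cutsOnce-wrap a u P [] a≢u (subst (λ L → occ L u ≡ 0) (sym (++-identityʳ P)) P-no-u)
                           (subst (CutsOnce a) (sym (++-identityʳ P)) cuts)
      where
      P-no-u : occ P u ≡ 0
      P-no-u = ℕP.m+n≡0⇒m≡0 (occ P u) (trans (sym (occ-++ P Q u)) PQ-no-u)

    newLabels : ∀ {L} → All (Explored vis) L → All (λ q → q ≢ u × lab q < k) L
    newLabels = All.map (λ {z} vz → explored≢u vz , labelBound z vz)

    dominates-a : LabelDominates lab′ (u ∷ (P ∷ʳ u)) Q
    dominates-a = subst (λ L → LabelDominates lab′ L Q) (cong (u ∷_) (++-identityʳ (P ∷ʳ u)))
      (labelDominates-wrap lab u k P [] Q (subst (λ L → LabelDominates lab L Q) (sym (++-identityʳ P)) dominates)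
        (subst (All (_≢ u)) (sym (++-identityʳ P)) P∌u) (newLabels Q-explored))

    cuts-deeper : ∀ top″ a′ X′ rest′ → rest ≡ top″ ++ (a′ , X′) ∷ rest′ →
      CutsOnce a′ (u ∷ ((P ∷ʳ u) ++ (blocks top″ ++ X′))) ×
      LabelDominates lab′ (u ∷ ((P ∷ʳ u) ++ (blocks top″ ++ X′))) (word rest′)
    cuts-deeper top″ a′ X′ rest′ rest≡ =
      subst (CutsOnce a′) (sym (wrap-assoc u P R)) (cutsOnce-wrap a′ u P R a′≢u PR-no-u cuts′) ,
      labelDominates-wrap lab u k P R (word rest′) dominates′ (All.map explored≢u PR-explored) (newLabels rest′-explored)
      where
      R : List (Fin n)
      R = blocks top″ ++ X′
      split′ : st ≡ (top ++ (a , X) ∷ top″) ++ (a′ , X′) ∷ rest′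
      split′ = trans split (trans (cong (λ Z → top ++ (a , X) ∷ Z) rest≡)
                                  (sym (++-assoc top ((a , X) ∷ top″) ((a′ , X′) ∷ rest′))))
      prefix≡ : blocks (top ++ (a , X) ∷ top″) ++ X′ ≡ P ++ R
      prefix≡ = begin
        blocks (top ++ (a , X) ∷ top″) ++ X′        ≡⟨ cong (_++ X′) (blocks-++ top ((a , X) ∷ top″)) ⟩
        (blocks top ++ X ++ blocks top″) ++ X′      ≡⟨ ++-assoc (blocks top) (X ++ blocks top″) X′ ⟩
        blocks top ++ (X ++ blocks top″) ++ X′      ≡⟨ cong (blocks top ++_) (++-assoc X (blocks top″) X′) ⟩
        blocks top ++ X ++ R                        ≡⟨ ++-assoc (blocks top) X R ⟨
        P ++ R                                      ∎
        where open ≡-Reasoning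
      old-cut : CutsOnce a′ (P ++ R) × LabelDominates lab (P ++ R) (word rest′)
      old-cut = subst (λ L → CutsOnce a′ L × LabelDominates lab L (word rest′)) prefix≡
                      (stacked (top ++ (a , X) ∷ top″) a′ X′ rest′ split′)
      cuts′ : CutsOnce a′ (P ++ R)
      cuts′ = proj₁ old-cut
      dominates′ : LabelDominates lab (P ++ R) (word rest′)
      dominates′ = proj₂ old-cut
      word≡′ : word st ≡ (P ++ R) ++ word rest′
      word≡′ = trans (cong word split′)
                     (trans (word-split (top ++ (a , X) ∷ top″) (a′ , X′) rest′) (cong (_++ word rest′) prefix≡))
      all-explored : All (Explored vis) ((P ++ R) ++ word rest′)
      all-explored = subst (All (Explored vis)) word≡′ letters
      PR-explored : All (Explored vis) (P ++ R)
      PR-explored = AllP.++⁻ˡ (P ++ R) all-explored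
      rest′-explored : All (Explored vis) (word rest′)
      rest′-explored = AllP.++⁻ʳ (P ++ R) all-explored
      PR-no-u : occ (P ++ R) u ≡ 0
      PR-no-u = ℕP.m+n≡0⇒m≡0 (occ (P ++ R) u)
        (trans (sym (occ-++ (P ++ R) (word rest′) u)) (trans (cong (λ L → occ L u) (sym word≡′)) (absent u u-new)))
      a′≢u : a′ ≢ u
      a′≢u = explored≢u (All.head (AllP.++⁻ʳ (top ++ (a , X) ∷ top″)
                                   (subst (All (λ e → Explored vis (proj₁ e))) split′ onStack)))

    stacked′ : WellStacked lab′ st′
    stacked′ = wellStacked-push lab′ u a P rest cuts-u dominates-u cuts-a dominates-a cuts-deeper

    onStack′ : All (λ e → Explored vis′ (proj₁ e)) st′
    onStack′ = update-here vis u true ∷ explored-keep a-explored ∷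
               All.map explored-keep (All.tail (AllP.++⁻ʳ top split-explored))

    labelBound′ : ∀ z → Explored vis′ z → lab′ z < suc k
    labelBound′ z v′z = byCase (z ≟ u)
      where
      byCase : Dec (z ≡ u) → lab′ z < suc k
      byCase (yes refl) = subst (_< suc k) (sym (update-here lab u k)) ℕP.≤-refl
      byCase (no z≢u)   = subst (_< suc k) (sym (update-there lab u k z≢u))
                                (ℕP.m<n⇒m<1+n (labelBound z (explored-back v′z z≢u)))

    injective′ : ∀ x y → Explored vis′ x → Explored vis′ y → lab′ x ≡ lab′ y → x ≡ y
    injective′ x y v′x v′y lx≡ly = byCase (x ≟ u) (y ≟ u)
      where
      -- an old vertex has a label below k = lab′ u
      old≢new : ∀ {z} → Explored vis′ z → z ≢ u → lab′ z ≢ lab′ u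
      old≢new {z} v′z z≢u eq = ℕP.<-irrefl (trans (sym (update-there lab u k z≢u)) (trans eq (update-here lab u k)))
                                             (labelBound z (explored-back v′z z≢u))
      byCase : Dec (x ≡ u) → Dec (y ≡ u) → x ≡ y
      byCase (yes x≡u)  (yes y≡u) = trans x≡u (sym y≡u)
      byCase (yes refl) (no y≢u)  = ⊥-elim (old≢new v′y y≢u (sym lx≡ly))
      byCase (no x≢u)   (yes refl) = ⊥-elim (old≢new v′x x≢u lx≡ly)
      byCase (no x≢u)   (no y≢u)  =
        injective x y (explored-back v′x x≢u) (explored-back v′y y≢u)
          (trans (sym (update-there lab u k x≢u)) (trans lx≡ly (update-there lab u k y≢u)))

    -- the popped entries were done; the others are still on the stack
    finished′ : ∀ z w → Explored vis′ z → ¬ OnStack z st′ → Edge G z w → Explored vis′ w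
    finished′ z w v′z z∉st′ z–w with Any.any? (λ e → z ≟ proj₁ e) st
    ... | no z∉st = explored-keep (finished z w (explored-back v′z (λ z≡u → z∉st′ (here z≡u))) z∉st z–w)
    ... | yes z∈st with AnyP.++⁻ top (subst (OnStack z) split z∈st)
    ...   | inj₁ z∈top with All.lookupAny topDone z∈top
    ...     | done , z≡ = explored-keep (done w (subst (λ v → Edge G v w) z≡ z–w))
    finished′ z w v′z z∉st′ z–w | yes _ | inj₂ (here z≡a)      = ⊥-elim (z∉st′ (there (here z≡a)))
    finished′ z w v′z z∉st′ z–w | yes _ | inj₂ (there z∈rest)  = ⊥-elim (z∉st′ (there (there z∈rest)))

    -- u is joined to the explored vertices through a
    connected′ : ∀ b c → Explored vis′ b → Explored vis′ c →
                 ∃ λ L → Path b c L × AllPairs _≢_ L × All (Explored vis′) L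
    connected′ b c v′b v′c = byCase (b ≟ u) (c ≟ u)
      where
      keepAll : ∀ {L} → All (Explored vis) L → All (Explored vis′) L
      keepAll = All.map explored-keep
      byCase : Dec (b ≡ u) → Dec (c ≡ u) → ∃ λ L → Path b c L × AllPairs _≢_ L × All (Explored vis′) L
      byCase (yes refl) (yes refl) = u ∷ [] , one u , [] ∷ [] , update-here vis u true ∷ []
      byCase (yes refl) (no c≢u) with connected a c a-explored (explored-back v′c c≢u)
      ... | L , path , distinct , L-explored =
        u ∷ L , cons (edge-sym a–u) path ,
        All.map (λ vz u≡z → explored≢u vz (sym u≡z)) L-explored ∷ distinct ,
        update-here vis u true ∷ keepAll L-explored
      byCase (no b≢u) (yes refl) with connected b a (explored-back v′b b≢u) a-explored
      ... | L , path , distinct , L-explored =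
        L ∷ʳ u , path-snoc path a–u ,
        AllPairsP.++⁺ distinct ([] ∷ []) (All.map (λ vz → explored≢u vz ∷ []) L-explored) ,
        AllP.++⁺ (keepAll L-explored) (update-here vis u true ∷ [])
      byCase (no b≢u) (no c≢u) with connected b c (explored-back v′b b≢u) (explored-back v′c c≢u)
      ... | L , path , distinct , L-explored = L , path , distinct , keepAll L-explored

    state′ : State
    state′ = mkState vis′ (suc k) lab′ st′

    invariant′ : Invariant state′
    invariant′ = record
      { twice = twice′ ; absent = absent′ ; letters = letters′ ; represents = represents′
      ; avoids = avoids′ ; stacked = stacked′ ; onStack = onStack′ ; labelBound = labelBound′
      ; injective = injective′ ; finished = finished′ ; connected = connected′
      ; rootExplored = explored-keep rootExplored }

  unexploredNeighbour? : ∀ (vis : Fin n → Bool) a → Dec (∃ λ w → Edge G a w × vis w ≡ false)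
  unexploredNeighbour? vis a = FinP.any? (λ w → (adj G a w Bool.≟ true) ×-dec (vis w Bool.≟ false))

  done-of : ∀ (vis : Fin n → Bool) a (X : List (Fin n)) → ¬ (∃ λ w → Edge G a w × vis w ≡ false) → Done vis (a , X)
  done-of vis a X none w a–w with vis w in eq
  ... | true  = refl
  ... | false = ⊥-elim (none (w , a–w , eq))

  Active : (Fin n → Bool) → List (Entry n) → Set
  Active vis st = ∃ λ top → ∃ λ a → ∃ λ X → ∃ λ rest → ∃ λ u →
    st ≡ top ++ (a , X) ∷ rest × All (Done vis) top × Edge G a u × vis u ≡ false

  findActive : ∀ (vis : Fin n → Bool) st → All (Done vis) st ⊎ Active vis st
  findActive vis [] = inj₁ []
  findActive vis ((a , X) ∷ st) with unexploredNeighbour? vis a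
  ... | yes (u , a–u , new) = inj₂ ([] , a , X , st , u , refl , [] , a–u , new)
  ... | no none with findActive vis st
  ...   | inj₁ allDone = inj₁ (done-of vis a X none ∷ allDone)
  ...   | inj₂ (top , b , Y , rest , u , split , topDone , b–u , new) =
          inj₂ ((a , X) ∷ top , b , Y , rest , u , cong ((a , X) ∷_) split , done-of vis a X none ∷ topDone , b–u , new)

  -- The number of unexplored vertices in a list decreases with each
  -- discovery; it bounds the number of search steps.
  unexplored : (Fin n → Bool) → List (Fin n) → ℕ
  unexplored vis []      = 0
  unexplored vis (z ∷ L) = if vis z then unexplored vis L else suc (unexplored vis L)

  unexplored-mono : ∀ vis u L → unexplored (update vis u true) L ≤ unexplored vis L
  unexplored-mono vis u [] = z≤n
  unexplored-mono vis u (z ∷ L) with z ≟ u | vis z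
  ... | yes _ | true  = unexplored-mono vis u L
  ... | yes _ | false = ℕP.m≤n⇒m≤1+n (unexplored-mono vis u L)
  ... | no _  | true  = unexplored-mono vis u L
  ... | no _  | false = s≤s (unexplored-mono vis u L)

  unexplored-decreases : ∀ vis u L → Any (u ≡_) L → vis u ≡ false →
                         unexplored (update vis u true) L < unexplored vis L
  unexplored-decreases vis u (z ∷ L) (here refl) new rewrite update-here vis u true | new = s≤s (unexplored-mono vis u L)
  unexplored-decreases vis u (z ∷ L) (there u∈L) new with z ≟ u | vis z
  ... | yes _ | true  = unexplored-decreases vis u L u∈L new
  ... | yes _ | false = ℕP.m<n⇒m<1+n (unexplored-decreases vis u L u∈L new)
  ... | no _  | true  = unexplored-decreases vis u L u∈L new
  ... | no _  | false = s≤s (unexplored-decreases vis u L u∈L new)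

  module Run (isConnected : Connected G) where

    -- when every stack entry is done, connectivity forces every vertex
    -- to be explored: explored vertices are closed under adjacency
    explored-all : ∀ S → Invariant S → All (Done (State.vis S)) (State.st S) → ∀ z → Explored (State.vis S) z
    explored-all S I allDone z = along (isConnected r z) (Invariant.rootExplored I)
      where
      spread : ∀ {v w} → Edge G v w → Explored (State.vis S) v → Explored (State.vis S) w
      spread {v} {w} v–w vv with Any.any? (λ e → v ≟ proj₁ e) (State.st S)
      ... | no v∉st = Invariant.finished I v w vv v∉st v–w
      ... | yes v∈st with All.lookupAny allDone v∈st
      ...   | done , v≡ = done w (subst (λ x → Edge G x w) v≡ v–w)
      along : ∀ {v z} → Walk G v z → Explored (State.vis S) v → Explored (State.vis S) z
      along (stop _)      vv = vv
      along (step v–w p)  vv = along p (spread v–w vv)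

    representation : ∀ S → Invariant S → (∀ z → Explored (State.vis S) z) → TwoUniform132Representable G
    representation (mkState vis k lab st) I all-explored =
      lab , (λ {x} {y} → injective x y (all-explored x) (all-explored y)) ,
      word st , (λ v → twice v (all-explored v)) , represents-word ,
      avoids132ᵢ⇒avoids132 (map lab (word st)) avoids
      where
      open Invariant I
      represents-word : Represents (word st) G
      represents-word x y x≢y with represents x y (all-explored x) (all-explored y) x≢y
      ... | toEdge , toAlt = (λ alt → toEdge (alternate⇒alternating (word st) x y alt)) ,
                             (λ e → alternating⇒alternate (word st) x y x≢y (toAlt e))

    search : (fuel : ℕ) → ∀ S → Invariant S → unexplored (State.vis S) (allFin n) ≤ fuel →
             TwoUniform132Representable G
    search fuel S@(mkState vis k lab st) I bound with findActive vis st
    ... | inj₁ allDone = representation S I (explored-all S I allDone)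
    ... | inj₂ (top , a , X , rest , u , split , topDone , a–u , new) =
      continue fuel (ℕP.<-≤-trans (unexplored-decreases vis u (allFin n) (∈-allFin u) new) bound)
      where
      open Discover vis k lab st I top a X rest split topDone u a–u new
      continue : ∀ fuel → unexplored vis′ (allFin n) < fuel → TwoUniform132Representable G
      continue (suc fuel′) (s≤s bound′) = search fuel′ state′ invariant′ bound′

    vis₀ : Fin n → Bool
    vis₀ = update (λ _ → false) r true

    explored₀ : Explored vis₀ r
    explored₀ = update-here (λ _ → false) r true

    only-root : ∀ {z} → Explored vis₀ z → z ≡ r
    only-root {z} vz with z ≟ r
    ... | yes z≡r = z≡r
    ... | no _    with vz
    ...   | ()

    initial : Invariant (mkState vis₀ 1 (λ _ → 0) ((r , r ∷ []) ∷ []))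
    initial = record
      { twice = λ z vz → subst (λ v → occ (r ∷ r ∷ []) v ≡ 2) (sym (only-root vz))
                               (trans (occ-hit (r ∷ []) refl) (cong suc (occ-hit [] {r} refl)))
      ; absent = λ z nz → let r≢z = λ (r≡z : r ≡ z) → unexplored-root (subst (λ v → vis₀ v ≡ false) (sym r≡z) nz)
                          in trans (occ-miss (r ∷ []) r≢z) (occ-miss [] r≢z)
      ; letters = explored₀ ∷ explored₀ ∷ []
      ; represents = λ x y vx vy x≢y → ⊥-elim (x≢y (trans (only-root vx) (sym (only-root vy))))
      ; avoids = inj₂ (z≤n , tt) , tt , tt
      ; stacked = stacked₀
      ; onStack = explored₀ ∷ []
      ; labelBound = λ _ _ → s≤s z≤n
      ; injective = λ x y vx vy _ → trans (only-root vx) (sym (only-root vy))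
      ; finished = λ z w vz z∉st _ → ⊥-elim (z∉st (here (only-root vz)))
      ; connected = connected₀
      ; rootExplored = explored₀ }
      where
      unexplored-root : vis₀ r ≢ false
      unexplored-root eq with trans (sym explored₀) eq
      ... | ()
      stacked₀ : WellStacked (λ _ → 0) ((r , r ∷ []) ∷ [])
      stacked₀ [] a X rest refl =
        (occ-hit [] {r} refl , λ z z≢r → inj₁ (occ-miss [] (λ r≡z → z≢r (sym r≡z)))) , (z≤n ∷ []) ∷ []
      stacked₀ (_ ∷ []) a X rest ()
      stacked₀ (_ ∷ _ ∷ _) a X rest ()
      connected₀ : ∀ a b → Explored vis₀ a → Explored vis₀ b →
                   ∃ λ L → Path a b L × AllPairs _≢_ L × All (Explored vis₀) L
      connected₀ a b va vb with only-root {a} va | only-root {b} vb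
      ... | refl | refl = r ∷ [] , one r , [] ∷ [] , explored₀ ∷ []

    result : TwoUniform132Representable G
    result = search (unexplored vis₀ (allFin n)) _ initial ℕP.≤-refl

theorem4p4 : ∀ (n : ℕ) (G : Graph n) → IsTree G → TwoUniform132Representable G
-- (the empty graph is represented by the empty word)
theorem4p4 zero    G _                   = (λ ()) , (λ { {()} }) , [] , (λ ()) , (λ ()) , avoids132ᵢ⇒avoids132 [] tt
theorem4p4 (suc m) G (connected , acyclic) = Search.Run.result G acyclic zero connected
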